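{- Let $D=\{(x,y)\in\mathbb{Q}^2\mid x<y\}$, and let $\Gamma$ be the relational structure with domain $D$ whose relations are all binary relations $R\subseteq D^2$ such that the $4$-ary relation $\{(x,y,u,v)\in\mathbb{Q}^4\mid ((x,y),(u,v))\in R\}$ is first-order definable in $(\mathbb{Q};<)$ (Allen's Interval Algebra). Then the age of $\Gamma$ has the Ramsey property.
   Context: The \emph{age} of a structure is the class of finite structures isomorphic to a finite induced substructure of it. For structures $S,H,P$ and $k\geq1$, $S\rightarrow(H)^P_k$ means that for every coloring with $k$ colors of the copies of $P$ in $S$ (induced substructures isomorphic to $P$) there is a copy $H'$ of $H$ in $S$ such that all copies of $P$ in $H'$ have the same color. A class $\mathcal C$ of finite structures, closed under isomorphisms and induced substructures and with the joint embedding property, has the \emph{Ramsey property} (is a Ramsey class) if for all $k\geq1$ and $H,P\in\mathcal C$ there exists $S\in\mathcal C$ with $S\rightarrow(H)^P_k$. -}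

module Defs where

open import Data.Nat using (ℕ; suc; _≤_)
open import Data.Fin using (Fin)
open import Data.Fin.Subset using (Subset; _∈_; _⊆_)
open import Data.Rational using (ℚ; _<_)
open import Data.Product using (Σ; ∃; _×_; _,_; proj₁; proj₂)
open import Data.Sum using (_⊎_)
open import Data.Empty using (⊥)
open import Data.Unit using (⊤)
open import Relation.Nullary using (¬_)
open import Relation.Binary.PropositionalEquality using (_≡_)
open import Function using (_⇔_)
open import Function.Definitions using (Injective)

-- First-order logic over the structure (ℚ; <), with equality.
-- Formulas with n free variables (de Bruijn indices, Fin n).

data Formula : ℕ → Set where
  tt ff     : ∀ {n} → Formula n
  _≺_ _≈_   : ∀ {n} → Fin n → Fin n → Formula n
  ¬'_       : ∀ {n} → Formula n → Formula n
  _∧'_ _∨'_ _⇒'_ : ∀ {n} → Formula n → Formula n → Formula n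
  ∃'_ ∀'_   : ∀ {n} → Formula (suc n) → Formula n

extend : ∀ {n} → ℚ → (Fin n → ℚ) → Fin (suc n) → ℚ
extend q ρ Fin.zero = q
extend q ρ (Fin.suc i) = ρ i

⟦_⟧ : ∀ {n} → Formula n → (Fin n → ℚ) → Set
⟦ tt ⟧ ρ = ⊤
⟦ ff ⟧ ρ = ⊥
⟦ i ≺ j ⟧ ρ = ρ i < ρ j
⟦ i ≈ j ⟧ ρ = ρ i ≡ ρ j
⟦ ¬' φ ⟧ ρ = ¬ ⟦ φ ⟧ ρ
⟦ φ ∧' ψ ⟧ ρ = ⟦ φ ⟧ ρ × ⟦ ψ ⟧ ρ
⟦ φ ∨' ψ ⟧ ρ = ⟦ φ ⟧ ρ ⊎ ⟦ ψ ⟧ ρ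
⟦ φ ⇒' ψ ⟧ ρ = ⟦ φ ⟧ ρ → ⟦ ψ ⟧ ρ
⟦ ∃' φ ⟧ ρ = Σ ℚ λ q → ⟦ φ ⟧ (extend q ρ)
⟦ ∀' φ ⟧ ρ = (q : ℚ) → ⟦ φ ⟧ (extend q ρ)

env4 : ℚ → ℚ → ℚ → ℚ → Fin 4 → ℚ
env4 x y u v Fin.zero = x
env4 x y u v (Fin.suc Fin.zero) = y
env4 x y u v (Fin.suc (Fin.suc Fin.zero)) = u
env4 x y u v (Fin.suc (Fin.suc (Fin.suc Fin.zero))) = v

-- The relations of Γ are indexed by 4-variable formulas φ:
-- R_φ = {((x,y),(u,v)) | (ℚ;<) ⊨ φ(x,y,u,v)}. Every first-order definable
-- 4-ary relation arises this way (possibly from several formulas).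

D : Set
D = Σ (ℚ × ℚ) (λ p → proj₁ p < proj₂ p)

pt : D → ℚ × ℚ
pt = proj₁

ΓRel : Formula 4 → D → D → Set
ΓRel φ ((x , y) , _) ((u , v) , _) = ⟦ φ ⟧ (env4 x y u v)

-- Finite structures in the signature of Γ (one binary symbol per formula).

record FinStr : Set₁ where
  field
    size : ℕ
    rel  : Formula 4 → Fin size → Fin size → Set
open FinStr public

record Emb (A B : FinStr) : Set where
  field
    map      : Fin (size A) → Fin (size B)
    injective : Injective _≡_ _≡_ map
    preserves : ∀ φ i j → rel A φ i j ⇔ rel B φ (map i) (map j)
open Emb public

record EmbΓ (A : FinStr) : Set where
  field
    map      : Fin (size A) → D
    injective : ∀ i j → pt (map i) ≡ pt (map j) → i ≡ j
    preserves : ∀ φ i j → rel A φ i j ⇔ ΓRel φ (map i) (map j)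

-- The age of Γ: finite structures isomorphic to a finite induced
-- substructure of Γ, i.e. embeddable into Γ.
InAgeΓ : FinStr → Set
InAgeΓ A = EmbΓ A

_⊆Im_ : ∀ {A B} → Subset (size B) → Emb A B → Set
X ⊆Im e = ∀ s → s ∈ X → ∃ λ i → map e i ≡ s

IsCopy : (P S : FinStr) → Subset (size S) → Set
IsCopy P S X = Σ (Emb P S) λ e → ∀ s → (s ∈ X ⇔ (∃ λ i → map e i ≡ s))

-- S → (H)^P_k. A colouring of the copies of P is given as a colouring of
-- all subsets of dom(S) (only its values on copies matter).
Arrow : (S H P : FinStr) (k : ℕ) → Set
Arrow S H P k =
  (χ : Subset (size S) → Fin k) →
  Σ (Emb H S) λ e → Σ (Fin k) λ c →
    ∀ X → IsCopy P S X → X ⊆Im e → χ X ≡ c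

RamseyAgeΓ : Set₁
RamseyAgeΓ = ∀ (k : ℕ) → 1 ≤ k → ∀ (H P : FinStr) → InAgeΓ H → InAgeΓ P →
  Σ FinStr λ S → InAgeΓ S × Arrow S H P k

module Submission where

open import Defs

-- Since (ℚ; <) is homogeneous, a relation of Γ between two
-- intervals depends only on the order type of their four endpoints
-- (formula-invariant, Γ-transfer), so copies can be moved by any map that is
-- strictly increasing on their endpoints.  Given H, P and k+1 colours, let K
-- exceed the endpoint ranks in P and let S consist of all intervals with
-- natural endpoints below a large N (Grid).  A K-list ys of naturals places a
-- copy of P in S (the endpoint of rank r goes to ys[r]); colouring ys by the
-- colour of that copy, the finite Ramsey theorem (FiniteRamsey) yields a long
-- homogeneous list zs.  H is embedded through zs with its endpoint ranks
-- spread far apart (Spread), so that every copy of P inside it is placed by a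
-- K-sublist of zs (Interpolation, AscendingLists.select) and has the colour
-- of zs.

module FiniteRamsey where
  open import Data.Nat using (ℕ; zero; suc; _+_; _*_; _≤_; _≤?_; s≤s)
  open import Data.Nat.Properties
    using (+-suc; +-identityʳ; +-cancelˡ-≤; +-monoˡ-≤; ≤-trans; ≤-reflexive; <⇒≤; ≰⇒>;
           suc-injective; m≤n⇒m⊓n≡m)
  open import Data.Fin using (Fin; zero; suc)
  open import Data.List using (List; []; _∷_; length; take)
  import Data.List as List
  open import Data.List.Properties using (length-map; length-take)
  open import Data.List.Relation.Binary.Sublist.Propositional using (_⊆_; []; _∷_; _∷ʳ_; ⊆-trans; minimum)
  open import Data.List.Relation.Binary.Sublist.Propositional.Properties using (map⁺; All-resp-⊆; take-⊆)
  open import Data.List.Relation.Unary.All using (All; []; _∷_; universal; zipWith)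
  open import Data.Product using (Σ; _×_; _,_; proj₁; proj₂)
  open import Data.Unit using (⊤; tt)
  open import Relation.Nullary using (yes; no)
  open import Relation.Binary.PropositionalEquality using (_≡_; refl; sym; trans; cong; subst)

  prefix : {A : Set} (M : ℕ) (xs : List A) → M ≤ length xs →
           Σ (List A) λ zs → zs ⊆ xs × length zs ≡ M
  prefix M xs M≤ = take M xs , take-⊆ M xs , trans (length-take M xs) (m≤n⇒m⊓n≡m M≤)

  module Split {B : Set} {k : ℕ} (col : B → Fin (suc (suc k))) where
    record Splitting (xs : List B) : Set where
      field
        first rest          : List B
        first⊆              : first ⊆ xs
        rest⊆               : rest ⊆ xs
        lengths             : length first + length rest ≡ length xs
        first-coloured-zero : All (λ x → col x ≡ zero) first
        rest-coloured-suc   : All (λ x → Σ (Fin (suc k)) λ c → col x ≡ suc c) rest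

    split : (xs : List B) → Splitting xs
    split [] = record { first = [] ; rest = [] ; first⊆ = [] ; rest⊆ = [] ; lengths = refl
                      ; first-coloured-zero = [] ; rest-coloured-suc = [] }
    split (x ∷ xs) with split xs | col x in eq
    ... | s | zero = record
      { first = x ∷ first ; rest = rest ; first⊆ = refl ∷ first⊆ ; rest⊆ = x ∷ʳ rest⊆
      ; lengths = cong suc lengths ; first-coloured-zero = eq ∷ first-coloured-zero
      ; rest-coloured-suc = rest-coloured-suc }
      where open Splitting s
    ... | s | suc c = record
      { first = first ; rest = x ∷ rest ; first⊆ = x ∷ʳ first⊆ ; rest⊆ = refl ∷ rest⊆
      ; lengths = trans (+-suc (length first) (length rest)) (cong suc lengths)
      ; first-coloured-zero = first-coloured-zero ; rest-coloured-suc = (c , eq) ∷ rest-coloured-suc }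
      where open Splitting s

  dropFirst : ∀ {k} → Fin (suc (suc k)) → Fin (suc k)
  dropFirst zero = zero
  dropFirst (suc c) = c

  pigeonhole : ∀ k M {B : Set} (col : B → Fin (suc k)) (xs : List B) → suc k * M ≤ length xs →
               Σ (Fin (suc k)) λ κ → Σ (List B) λ zs →
                 zs ⊆ xs × length zs ≡ M × All (λ x → col x ≡ κ) zs
  pigeonhole zero M col xs le with prefix M xs (subst (_≤ length xs) (+-identityʳ M) le)
  ... | zs , zs⊆ , len = zero , zs , zs⊆ , len , universal onlyColour zs
    where onlyColour : ∀ x → col x ≡ zero
          onlyColour x with col x
          ... | zero = refl
  pigeonhole (suc k) M {B} col xs le = fromSplitting (Split.split col xs)
    where
    open Split col using (Splitting)
    open Splitting
    Result : Set
    Result = Σ (Fin (suc (suc k))) λ κ → Σ (List B) λ zs →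
               zs ⊆ xs × length zs ≡ M × All (λ x → col x ≡ κ) zs

    -- Either M elements have the first colour, or the others are numerous
    -- enough for the pigeonhole principle with one colour fewer.
    fromSplitting : Splitting xs → Result
    fromSplitting s with M ≤? length (first s)
    ... | yes M≤ with prefix M (first s) M≤
    ...   | zs , zs⊆ , len = zero , zs , ⊆-trans zs⊆ (first⊆ s) , len , All-resp-⊆ zs⊆ (first-coloured-zero s)
    fromSplitting s | no M≰ with pigeonhole k M (λ x → dropFirst (col x)) (rest s) restLong
      where
      restLong : suc k * M ≤ length (rest s)
      restLong = +-cancelˡ-≤ (length (first s)) _ _
                   (≤-trans (+-monoˡ-≤ _ (<⇒≤ (≰⇒> M≰))) (subst (M + suc k * M ≤_) (sym (lengths s)) le))
    ... | κ , zs , zs⊆ , len , mono =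
      suc κ , zs , ⊆-trans zs⊆ (rest⊆ s) , len ,
      zipWith recolour (All-resp-⊆ zs⊆ (rest-coloured-suc s) , mono)
      where
      recolour : ∀ {x} → (Σ (Fin (suc k)) λ c → col x ≡ suc c) × dropFirst (col x) ≡ κ → col x ≡ suc κ
      recolour ((c , eq) , eq') rewrite eq = cong suc eq'

  Homogeneous : {A C : Set} (c : List A → C) (K : ℕ) (zs : List A) (κ : C) → Set
  Homogeneous c K zs κ = ∀ ys → ys ⊆ zs → length ys ≡ K → c ys ≡ κ

  -- Ramsey numbers: ramseyBound K k M elements suffice for K-sublists,
  -- k+1 colours and a homogeneous sublist of length M.  stepBound K k r is the
  -- length needed to build r elements of an "end-homogeneous" sequence.
  ramseyBound : ℕ → ℕ → ℕ → ℕ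
  stepBound : ℕ → ℕ → ℕ → ℕ
  ramseyBound zero k M = M
  ramseyBound (suc K) k M = stepBound K k (suc k * M)
  stepBound K k zero = zero
  stepBound K k (suc r) = suc (ramseyBound K k (stepBound K k r))

  -- The inductive step K ↦ K+1.  An end-homogeneous sequence records, for each
  -- element a, a colour κ such that c (a ∷ ys) ≡ κ for every K-sublist ys of
  -- the elements after a.
  module Step {A : Set} {k : ℕ} (K : ℕ) (c : List A → Fin (suc k)) where
    EndHomogeneous : List (A × Fin (suc k)) → Set
    EndHomogeneous [] = ⊤
    EndHomogeneous ((a , κ) ∷ ps) = Homogeneous (λ ys → c (a ∷ ys)) K (List.map proj₁ ps) κ × EndHomogeneous ps

    endHomogeneous-⊆ : ∀ {qs ps} → qs ⊆ ps → EndHomogeneous ps → EndHomogeneous qs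
    endHomogeneous-⊆ [] h = h
    endHomogeneous-⊆ (_ ∷ʳ qs⊆) (_ , h) = endHomogeneous-⊆ qs⊆ h
    endHomogeneous-⊆ (refl ∷ qs⊆) (hd , h) =
      (λ ys ys⊆ len → hd ys (⊆-trans ys⊆ (map⁺ proj₁ qs⊆)) len) , endHomogeneous-⊆ qs⊆ h

    homogeneous : ∀ qs κ → EndHomogeneous qs → All (λ p → proj₂ p ≡ κ) qs →
                  Homogeneous c (suc K) (List.map proj₁ qs) κ
    homogeneous [] κ h mono [] [] ()
    homogeneous (_ ∷ qs) κ (_ , h) (_ ∷ mono) ys (_ ∷ʳ ys⊆) len = homogeneous qs κ h mono ys ys⊆ len
    homogeneous (_ ∷ qs) κ (hd , _) (eq ∷ _) (_ ∷ ys) (refl ∷ ys⊆) len = trans (hd ys ys⊆ (suc-injective len)) eq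

  -- The finite Ramsey theorem, by induction on K: build an end-homogeneous
  -- sequence greedily, then apply the pigeonhole principle to its colours.
  ramsey : {A : Set} → ∀ K k M (xs : List A) → ramseyBound K k M ≤ length xs → (c : List A → Fin (suc k)) →
           Σ (List A) λ zs → zs ⊆ xs × length zs ≡ M × Σ (Fin (suc k)) λ κ → Homogeneous c K zs κ
  ramsey zero k M xs le c with prefix M xs le
  ... | zs , zs⊆ , len = zs , zs⊆ , len , c [] , λ { [] _ _ → refl }
  ramsey {A} (suc K) k M xs le c with endHomogeneousSequence (suc k * M) xs le
    where
    open Step K c
    endHomogeneousSequence : ∀ r (xs : List A) → stepBound K k r ≤ length xs →
      Σ (List (A × Fin (suc k))) λ ps → List.map proj₁ ps ⊆ xs × length ps ≡ r × EndHomogeneous ps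
    endHomogeneousSequence zero xs _ = [] , minimum xs , refl , tt
    endHomogeneousSequence (suc r) (x ∷ xs) (s≤s le)
      with ramsey K k (stepBound K k r) xs le (λ ys → c (x ∷ ys))
    ... | zs , zs⊆ , len , κ , hom with endHomogeneousSequence r zs (≤-reflexive (sym len))
    ... | ps , ps⊆ , len' , h = (x , κ) ∷ ps , refl ∷ ⊆-trans ps⊆ zs⊆ , cong suc len' ,
                                (λ ys ys⊆ → hom ys (⊆-trans ys⊆ ps⊆)) , h
  ... | ps , ps⊆ , len , h with pigeonhole k M proj₂ ps (≤-reflexive (sym len))
  ... | κ , qs , qs⊆ , len' , mono =
    List.map proj₁ qs , ⊆-trans (map⁺ proj₁ qs⊆) ps⊆ , trans (length-map proj₁ qs) len' ,
    κ , Step.homogeneous K c qs κ (Step.endHomogeneous-⊆ K c qs⊆ h) mono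

-- (ℚ; <) is homogeneous: first-order formulas cannot distinguish two
-- assignments of the same order type.  The proof is the usual
-- back-and-forth argument, one quantifier at a time.
module OrderInvariance where
  open import Data.Nat using (ℕ; zero; suc)
  open import Data.Fin using (Fin; zero; suc)
  open import Data.Rational using (ℚ; _<_; _≤_; _+_; _-_; -_; 1ℚ; _≟_)
  open import Data.Rational.Properties
    using (<-cmp; <-irrefl; <-asym; <-dense; <-≤-trans; ≤-<-trans; <-trans; ≤-total; ≤-trans; ≤-refl;
           +-monoʳ-<; +-identityʳ; positive⁻¹; negative⁻¹; _<?_)
  open import Data.Product using (Σ; _×_; _,_; proj₁; proj₂)
  open import Data.Product.Function.NonDependent.Propositional using (_×-⇔_)
  open import Data.Sum using (_⊎_; inj₁; inj₂)
  open import Data.Sum.Function.Propositional using (_⊎-⇔_)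
  open import Data.Empty using (⊥-elim)
  open import Function using (_⇔_; mk⇔; Equivalence; flip)
  open import Function.Properties.Equivalence using () renaming (refl to ⇔-refl)
  open import Function.Related.TypeIsomorphisms using (→-cong-⇔; ¬-cong-⇔)
  open import Relation.Nullary using (¬_; yes; no)
  open import Relation.Unary using (Decidable)
  open import Relation.Binary using (Reflexive; Total; Transitive)
  open import Relation.Binary.PropositionalEquality using (_≡_; refl; sym; subst)
  open import Relation.Binary.Definitions using (tri<; tri≈; tri>)
  open Equivalence using (to; from)

  <-+1 : ∀ p → p < p + 1ℚ
  <-+1 p = subst (_< p + 1ℚ) (+-identityʳ p) (+-monoʳ-< p (positive⁻¹ 1ℚ))

  -1-< : ∀ p → p - 1ℚ < p
  -1-< p = subst (p - 1ℚ <_) (+-identityʳ p) (+-monoʳ-< p (negative⁻¹ (- 1ℚ)))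

  SameType : ∀ {n} → (Fin n → ℚ) → (Fin n → ℚ) → Set
  SameType ρ ρ' = ∀ i j → (ρ i < ρ j) ⇔ (ρ' i < ρ' j)

  sameType-sym : ∀ {n} {ρ ρ' : Fin n → ℚ} → SameType ρ ρ' → SameType ρ' ρ
  sameType-sym st i j = mk⇔ (from (st i j)) (to (st i j))

  -- Equalities are part of the order type, since < is trichotomous.
  sameType-≡ : ∀ {n} {ρ ρ' : Fin n → ℚ} → SameType ρ ρ' → ∀ i j → ρ i ≡ ρ j → ρ' i ≡ ρ' j
  sameType-≡ {ρ = ρ} {ρ'} st i j eq with <-cmp (ρ' i) (ρ' j)
  ... | tri< lt _ _ = ⊥-elim (<-irrefl eq (from (st i j) lt))
  ... | tri≈ _ eq' _ = eq'
  ... | tri> _ _ gt = ⊥-elim (<-irrefl (sym eq) (from (st j i) gt))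

  maximalWitness : ∀ n (P : Fin n → Set) → Decidable P → {V : Set} (R : V → V → Set) →
                   Reflexive R → Total R → Transitive R → (v : Fin n → V) →
                   (∀ i → ¬ P i) ⊎ Σ (Fin n) λ i → P i × ∀ j → P j → R (v j) (v i)
  maximalWitness zero P P? R reflR totalR transR v = inj₁ λ ()
  maximalWitness (suc n) P P? R reflR totalR transR v
    with maximalWitness n (λ i → P (suc i)) (λ i → P? (suc i)) R reflR totalR transR (λ i → v (suc i)) | P? zero
  ... | inj₁ none | no ¬p₀ = inj₁ λ { zero → ¬p₀ ; (suc i) → none i }
  ... | inj₁ none | yes p₀ = inj₂ (zero , p₀ , λ { zero _ → reflR ; (suc j) pj → ⊥-elim (none j pj) })
  ... | inj₂ (i , pi , max) | no ¬p₀ = inj₂ (suc i , pi , λ { zero p₀ → ⊥-elim (¬p₀ p₀) ; (suc j) → max j })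
  ... | inj₂ (i , pi , max) | yes p₀ with totalR (v zero) (v (suc i))
  ...   | inj₁ v₀≤vi = inj₂ (suc i , pi , λ { zero _ → v₀≤vi ; (suc j) pj → max j pj })
  ...   | inj₂ vi≤v₀ = inj₂ (zero , p₀ , λ { zero _ → reflR ; (suc j) pj → transR (max j pj) vi≤v₀ })

  module Extension {n} {ρ ρ' : Fin n → ℚ} (st : SameType ρ ρ') (q : ℚ) where
    Matches : ℚ → Set
    Matches q' = ∀ j → ((ρ j < q) ⇔ (ρ' j < q')) × ((q < ρ j) ⇔ (q' < ρ' j))

    matches⇒sameType : ∀ q' → Matches q' → SameType (extend q ρ) (extend q' ρ')
    matches⇒sameType q' m zero zero =
      mk⇔ (λ q<q → ⊥-elim (<-irrefl refl q<q)) (λ q'<q' → ⊥-elim (<-irrefl refl q'<q'))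
    matches⇒sameType q' m zero (suc j) = proj₂ (m j)
    matches⇒sameType q' m (suc i) zero = proj₁ (m i)
    matches⇒sameType q' m (suc i) (suc j) = st i j

    Separates : ℚ → Set
    Separates q' = ∀ j → (ρ j < q → ρ' j < q') × (q < ρ j → q' < ρ' j)

    separates⇒matches : (∀ j → ¬ ρ j ≡ q) → ∀ q' → Separates q' → Matches q'
    separates⇒matches new q' sep j = mk⇔ (proj₁ (sep j)) below , mk⇔ (proj₂ (sep j)) above
      where
      below : ρ' j < q' → ρ j < q
      below lt with <-cmp (ρ j) q
      ... | tri< ρj<q _ _ = ρj<q
      ... | tri≈ _ eq _ = ⊥-elim (new j eq)
      ... | tri> _ _ q<ρj = ⊥-elim (<-asym lt (proj₂ (sep j) q<ρj))
      above : q' < ρ' j → q < ρ j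
      above lt with <-cmp (ρ j) q
      ... | tri< ρj<q _ _ = ⊥-elim (<-asym lt (proj₁ (sep j) ρj<q))
      ... | tri≈ _ eq _ = ⊥-elim (new j eq)
      ... | tri> _ _ q<ρj = q<ρj

    -- A separating point: above the largest image of a point below q and
    -- below the smallest image of a point above q, using density and the
    -- absence of endpoints.
    separating : Σ ℚ Separates
    separating with maximalWitness n (λ j → ρ j < q) (λ j → ρ j <? q) _≤_ ≤-refl ≤-total ≤-trans ρ'
                  | maximalWitness n (λ j → q < ρ j) (λ j → q <? ρ j)
                                   (flip _≤_) ≤-refl (flip ≤-total) (flip ≤-trans) ρ'
    ... | inj₁ noneBelow | inj₁ noneAbove =
      q , λ j → (λ p → ⊥-elim (noneBelow j p)) , (λ p → ⊥-elim (noneAbove j p))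
    ... | inj₂ (a , _ , max) | inj₁ noneAbove =
      ρ' a + 1ℚ , λ j → (λ p → ≤-<-trans (max j p) (<-+1 _)) , (λ p → ⊥-elim (noneAbove j p))
    ... | inj₁ noneBelow | inj₂ (b , _ , min) =
      ρ' b - 1ℚ , λ j → (λ p → ⊥-elim (noneBelow j p)) , (λ p → <-≤-trans (-1-< _) (min j p))
    ... | inj₂ (a , ρa<q , max) | inj₂ (b , q<ρb , min) with <-dense (to (st a b) (<-trans ρa<q q<ρb))
    ...   | m , ρ'a<m , m<ρ'b = m , λ j → (λ p → ≤-<-trans (max j p) ρ'a<m) , (λ p → <-≤-trans m<ρ'b (min j p))

    -- If q is an old value ρ i, take q' = ρ' i; otherwise a separating point.
    match : Σ ℚ λ q' → SameType (extend q ρ) (extend q' ρ')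
    match with maximalWitness n (λ j → ρ j ≡ q) (λ j → ρ j ≟ q) _≤_ ≤-refl ≤-total ≤-trans ρ'
    ... | inj₂ (i , refl , _) = ρ' i , matches⇒sameType (ρ' i) λ j → st j i , st i j
    ... | inj₁ new with separating
    ...   | q' , sep = q' , matches⇒sameType q' (separates⇒matches new q' sep)

  formula-invariant : ∀ {n} (φ : Formula n) {ρ ρ' : Fin n → ℚ} → SameType ρ ρ' → ⟦ φ ⟧ ρ ⇔ ⟦ φ ⟧ ρ'
  formula-invariant tt st = ⇔-refl
  formula-invariant ff st = ⇔-refl
  formula-invariant (i ≺ j) st = st i j
  formula-invariant (i ≈ j) st = mk⇔ (sameType-≡ st i j) (sameType-≡ (sameType-sym st) i j)
  formula-invariant (¬' φ) st = ¬-cong-⇔ (formula-invariant φ st)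
  formula-invariant (φ ∧' ψ) st = formula-invariant φ st ×-⇔ formula-invariant ψ st
  formula-invariant (φ ∨' ψ) st = formula-invariant φ st ⊎-⇔ formula-invariant ψ st
  formula-invariant (φ ⇒' ψ) st = →-cong-⇔ (formula-invariant φ st) (formula-invariant ψ st)
  formula-invariant (∃' φ) {ρ} {ρ'} st = mk⇔ forth back
    where
    forth : ⟦ ∃' φ ⟧ ρ → ⟦ ∃' φ ⟧ ρ'
    forth (q , holds) with Extension.match st q
    ... | q' , st' = q' , to (formula-invariant φ st') holds
    back : ⟦ ∃' φ ⟧ ρ' → ⟦ ∃' φ ⟧ ρ
    back (q' , holds) with Extension.match (sameType-sym st) q'
    ... | q , st' = q , to (formula-invariant φ st') holds
  formula-invariant (∀' φ) {ρ} {ρ'} st = mk⇔ forth back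
    where
    forth : ⟦ ∀' φ ⟧ ρ → ⟦ ∀' φ ⟧ ρ'
    forth holds q' with Extension.match (sameType-sym st) q'
    ... | q , st' = from (formula-invariant φ st') (holds q)
    back : ⟦ ∀' φ ⟧ ρ' → ⟦ ∀' φ ⟧ ρ
    back holds q with Extension.match st q
    ... | q' , st' = from (formula-invariant φ st') (holds q')

module FiniteFamilies where
  open import Data.Nat using (ℕ; zero; suc; _+_; _*_; _≤_; _<_; _⊔_; z≤n; s≤s)
  open import Data.Nat.Properties using (m≤m⊔n; m≤n⊔m; ⊔-lub; ≤-trans; +-mono-≤; +-mono-<-≤; +-mono-≤-<)
  open import Data.Fin using (Fin; zero; suc)

  maxOver : ∀ {n} → (Fin n → ℕ) → ℕ
  maxOver {zero} f = 0
  maxOver {suc n} f = f zero ⊔ maxOver (λ i → f (suc i))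

  ≤-maxOver : ∀ {n} (f : Fin n → ℕ) i → f i ≤ maxOver f
  ≤-maxOver f zero = m≤m⊔n _ _
  ≤-maxOver f (suc i) = ≤-trans (≤-maxOver (λ i → f (suc i)) i) (m≤n⊔m _ _)

  maxOver-≤ : ∀ {n} (f : Fin n → ℕ) {c} → (∀ i → f i ≤ c) → maxOver f ≤ c
  maxOver-≤ {zero} f h = z≤n
  maxOver-≤ {suc n} f h = ⊔-lub (h zero) (maxOver-≤ (λ i → f (suc i)) (λ i → h (suc i)))

  maxOver-< : ∀ {n} (f : Fin n → ℕ) {c} → 0 < c → (∀ i → f i < c) → maxOver f < c
  maxOver-< {zero} f 0<c h = 0<c
  maxOver-< {suc n} f {suc c} 0<c h =
    s≤s (⊔-lub (predʳ (h zero)) (predʳ (maxOver-< (λ i → f (suc i)) 0<c (λ i → h (suc i)))))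
    where predʳ : ∀ {a} → a < suc c → a ≤ c
          predʳ (s≤s a≤c) = a≤c

  sumOver : ∀ {n} → (Fin n → ℕ) → ℕ
  sumOver {zero} f = 0
  sumOver {suc n} f = f zero + sumOver (λ i → f (suc i))

  sumOver-≤ : ∀ {n} (f : Fin n → ℕ) {c} → (∀ i → f i ≤ c) → sumOver f ≤ n * c
  sumOver-≤ {zero} f h = z≤n
  sumOver-≤ {suc n} f h = +-mono-≤ (h zero) (sumOver-≤ (λ i → f (suc i)) (λ i → h (suc i)))

  sumOver-mono : ∀ {n} (f g : Fin n → ℕ) → (∀ i → f i ≤ g i) → sumOver f ≤ sumOver g
  sumOver-mono {zero} f g h = z≤n
  sumOver-mono {suc n} f g h = +-mono-≤ (h zero) (sumOver-mono (λ i → f (suc i)) (λ i → g (suc i)) (λ i → h (suc i)))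

  sumOver-strict : ∀ {n} (f g : Fin n → ℕ) → (∀ i → f i ≤ g i) → ∀ j → f j < g j → sumOver f < sumOver g
  sumOver-strict {suc n} f g h zero lt =
    +-mono-<-≤ lt (sumOver-mono (λ i → f (suc i)) (λ i → g (suc i)) (λ i → h (suc i)))
  sumOver-strict {suc n} f g h (suc j) lt =
    +-mono-≤-< (h zero) (sumOver-strict (λ i → f (suc i)) (λ i → g (suc i)) (λ i → h (suc i)) j lt)

-- Interpolation: a partial map σ(p) ↦ g(p) on finitely many points p that is
-- strictly monotone, with targets at least K+1 apart and at least K, extends
-- to a strictly increasing Φ : ℕ → ℕ mapping [0, K) into [0, Mb).  The points
-- are the two endpoints (b : Bool) of n intervals.  Φ r is the largest value
-- forced by a point at or below r, namely g p + (r ∸ σ p), or r itself.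
module Interpolation where
  open import Data.Nat using (ℕ; suc; _+_; _∸_; _≤_; _<_; _⊔_; _≤?_; z≤n; s≤s)
  open import Data.Nat.Properties
  open import Data.Bool using (Bool; true; false)
  open import Data.Fin using (Fin)
  open import Data.Empty using (⊥-elim)
  open import Data.Sum using (inj₁; inj₂)
  open import Relation.Nullary using (yes; no)
  open import Relation.Binary.PropositionalEquality using (_≡_; refl; trans; cong; subst)
  open FiniteFamilies

  module Interpolate
    (n K Mb : ℕ) (σ g : Fin n → Bool → ℕ)
    (σ<K : ∀ i b → σ i b < K)
    (K≤g : ∀ i b → K ≤ g i b)
    (gap : ∀ i b j b' → g j b' < g i b → suc K + g j b' ≤ g i b)
    (g-mono : ∀ i b j b' → σ j b' < σ i b → g j b' < g i b)
    (g-resp : ∀ i b j b' → σ j b' ≡ σ i b → g j b' ≡ g i b)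
    (g+K<Mb : ∀ i b → g i b + K < Mb) (K<Mb : K < Mb) where

    forced : ℕ → Fin n → Bool → ℕ
    forced r i b with σ i b ≤? r
    ... | yes _ = g i b + (r ∸ σ i b)
    ... | no _ = 0

    forced-≤ : ∀ r i b → σ i b ≤ r → forced r i b ≡ g i b + (r ∸ σ i b)
    forced-≤ r i b le with σ i b ≤? r
    ... | yes _ = refl
    ... | no ¬le = ⊥-elim (¬le le)

    forcedBoth : ℕ → Fin n → ℕ
    forcedBoth r i = forced r i false ⊔ forced r i true

    forced≤forcedBoth : ∀ r i b → forced r i b ≤ forcedBoth r i
    forced≤forcedBoth r i false = m≤m⊔n _ _
    forced≤forcedBoth r i true = m≤n⊔m _ _

    Φ : ℕ → ℕ
    Φ r = r ⊔ maxOver (forcedBoth r)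

    forced≤Φ : ∀ r i b → forced r i b ≤ Φ r
    forced≤Φ r i b = ≤-trans (forced≤forcedBoth r i b) (≤-trans (≤-maxOver (forcedBoth r) i) (m≤n⊔m r _))

    -- At σ p, no point forces more than g p: points strictly below are
    -- mapped at least K+1 below g p, which absorbs the offset r ∸ σ.
    forced-at-σ : ∀ i b j b' → forced (σ i b) j b' ≤ g i b
    forced-at-σ i b j b' with σ j b' ≤? σ i b
    ... | no _ = z≤n
    ... | yes le with m≤n⇒m<n∨m≡n le
    ...   | inj₂ eq rewrite eq | n∸n≡0 (σ i b) | +-identityʳ (g j b') = ≤-reflexive (g-resp i b j b' eq)
    ...   | inj₁ lt = ≤-trans (+-monoʳ-≤ (g j b') (≤-trans (m∸n≤m (σ i b) (σ j b')) (<⇒≤ (σ<K i b))))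
                        (≤-trans (≤-trans (≤-reflexive (+-comm (g j b') K)) (n≤1+n _))
                                 (gap i b j b' (g-mono i b j b' lt)))

    forced-self : ∀ i b → forced (σ i b) i b ≡ g i b
    forced-self i b = trans (forced-≤ (σ i b) i b ≤-refl)
                            (trans (cong (g i b +_) (n∸n≡0 (σ i b))) (+-identityʳ (g i b)))

    Φ-σ : ∀ i b → Φ (σ i b) ≡ g i b
    Φ-σ i b = ≤-antisym
      (⊔-lub (≤-trans (<⇒≤ (σ<K i b)) (K≤g i b))
             (maxOver-≤ (forcedBoth (σ i b)) (λ j → ⊔-lub (forced-at-σ i b j false) (forced-at-σ i b j true))))
      (subst (_≤ Φ (σ i b)) (forced-self i b) (forced≤Φ (σ i b) i b))

    forced<Φsuc : ∀ r i b → forced r i b < Φ (suc r)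
    forced<Φsuc r i b with σ i b ≤? r
    ... | no _ = ≤-trans (s≤s z≤n) (m≤m⊔n (suc r) (maxOver (forcedBoth (suc r))))
    ... | yes le = subst (_≤ Φ (suc r)) grows (forced≤Φ (suc r) i b)
      where
      grows : forced (suc r) i b ≡ suc (g i b + (r ∸ σ i b))
      grows = trans (forced-≤ (suc r) i b (m≤n⇒m≤1+n le))
                    (trans (cong (g i b +_) (+-∸-assoc 1 le)) (+-suc (g i b) (r ∸ σ i b)))

    Φ-increasing : ∀ r → Φ r < Φ (suc r)
    Φ-increasing r = ⊔-lub (m≤m⊔n (suc r) (maxOver (forcedBoth (suc r))))
      (maxOver-< (forcedBoth r) (≤-trans (s≤s z≤n) (m≤m⊔n (suc r) (maxOver (forcedBoth (suc r)))))
                 (λ i → ⊔-lub (forced<Φsuc r i false) (forced<Φsuc r i true)))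

    forced<Mb : ∀ r → r < K → ∀ i b → forced r i b < Mb
    forced<Mb r r<K i b with σ i b ≤? r
    ... | no _ = ≤-trans (s≤s z≤n) (≤-trans r<K (≤-trans (m≤n+m K (g i b)) (<⇒≤ (g+K<Mb i b))))
    ... | yes _ = ≤-trans (s≤s (+-monoʳ-≤ (g i b) (≤-trans (m∸n≤m r (σ i b)) (<⇒≤ r<K)))) (g+K<Mb i b)

    Φ<Mb : ∀ r → r < K → Φ r < Mb
    Φ<Mb r r<K = ⊔-lub (<-trans r<K K<Mb)
      (maxOver-< (forcedBoth r) (≤-trans (s≤s z≤n) K<Mb)
                 (λ i → ⊔-lub (forced<Mb r r<K i false) (forced<Mb r r<K i true)))

-- Sublists of [a, a+n) are strictly increasing, so reading one off at a
-- strictly increasing sequence of positions yields a sublist again.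
module AscendingLists where
  open import Data.Nat using (ℕ; zero; suc; pred; _+_; _≤_; _<_; z≤n; s≤s)
  open import Data.Nat.Properties using (≤-refl; ≤-trans; n≤1+n; m≤m+n; +-suc; <⇒≤; ≤-reflexive)
  open import Data.List using (List; []; _∷_; length; applyUpTo)
  open import Data.List.Relation.Binary.Sublist.Propositional using (_⊆_; []; _∷_; _∷ʳ_; minimum)
  open import Data.List.Relation.Unary.All as All using (All; []; _∷_)
  open import Data.Product using (_×_; _,_)
  open import Relation.Binary.PropositionalEquality using (_≡_; refl; sym; cong; cong₂; subst)

  -- Total lookup (0 outside the list), convenient for index arithmetic.
  lookupD : List ℕ → ℕ → ℕ
  lookupD [] _ = 0
  lookupD (x ∷ xs) zero = x
  lookupD (x ∷ xs) (suc r) = lookupD xs r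

  range : ℕ → ℕ → List ℕ
  range a zero = []
  range a (suc n) = a ∷ range (suc a) n

  length-range : ∀ a n → length (range a n) ≡ n
  length-range a zero = refl
  length-range a (suc n) = cong suc (length-range (suc a) n)

  data Ascending : ℕ → List ℕ → Set where
    [] : ∀ {a} → Ascending a []
    _∷_ : ∀ {a x xs} → a ≤ x → Ascending (suc x) xs → Ascending a (x ∷ xs)

  ascending-weaken : ∀ {a b xs} → a ≤ b → Ascending b xs → Ascending a xs
  ascending-weaken a≤b [] = []
  ascending-weaken a≤b (b≤x ∷ asc) = ≤-trans a≤b b≤x ∷ asc

  range-bound : ∀ a n {x} → x < suc a + n → x < a + suc n
  range-bound a n {x} x< = subst (x <_) (sym (+-suc a n)) x<

  sublist-of-range : ∀ {zs} a n → zs ⊆ range a n → Ascending a zs × All (_< a + n) zs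
  sublist-of-range a zero [] = [] , []
  sublist-of-range a (suc n) (.a ∷ʳ zs⊆) with sublist-of-range (suc a) n zs⊆
  ... | asc , bounded = ascending-weaken (n≤1+n a) asc , All.map (range-bound a n) bounded
  sublist-of-range a (suc n) (refl ∷ zs⊆) with sublist-of-range (suc a) n zs⊆
  ... | asc , bounded = ≤-refl ∷ asc , range-bound a n (s≤s (m≤m+n a n)) ∷ All.map (range-bound a n) bounded

  lookup-≥ : ∀ {a xs} → Ascending a xs → ∀ r → r < length xs → a ≤ lookupD xs r
  lookup-≥ (a≤x ∷ asc) zero _ = a≤x
  lookup-≥ (a≤x ∷ asc) (suc r) (s≤s r<) = ≤-trans (≤-trans a≤x (n≤1+n _)) (lookup-≥ asc r r<)

  lookup-increasing : ∀ {a xs} → Ascending a xs → ∀ {r r'} → r < r' → r' < length xs →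
                      lookupD xs r < lookupD xs r'
  lookup-increasing (_ ∷ asc) {zero} {suc r'} _ (s≤s r'<) = lookup-≥ asc r' r'<
  lookup-increasing (_ ∷ asc) {suc r} {suc r'} (s≤s r<r') (s≤s r'<) = lookup-increasing asc r<r' r'<

  lookup-bounded : ∀ {B xs} → All (_< B) xs → ∀ r → r < length xs → lookupD xs r < B
  lookup-bounded (x<B ∷ _) zero _ = x<B
  lookup-bounded (_ ∷ bounded) (suc r) (s≤s r<) = lookup-bounded bounded r r<

  lookup-applyUpTo : ∀ (F : ℕ → ℕ) K r → r < K → lookupD (applyUpTo F K) r ≡ F r
  lookup-applyUpTo F (suc K) zero _ = refl
  lookup-applyUpTo F (suc K) (suc r) (s≤s r<K) = lookup-applyUpTo (λ x → F (suc x)) K r r<K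

  applyUpTo-cong : ∀ (F G : ℕ → ℕ) K → (∀ r → F r ≡ G r) → applyUpTo F K ≡ applyUpTo G K
  applyUpTo-cong F G zero F≗G = refl
  applyUpTo-cong F G (suc K) F≗G =
    cong₂ _∷_ (F≗G 0) (applyUpTo-cong (λ x → F (suc x)) (λ x → G (suc x)) K (λ r → F≗G (suc r)))

  lookup-∷ : ∀ z zs a → 1 ≤ a → lookupD (z ∷ zs) a ≡ lookupD zs (pred a)
  lookup-∷ z zs (suc a) _ = refl

  pred-< : ∀ {a b} → 1 ≤ a → a < b → pred a < pred b
  pred-< {suc a} {suc b} _ (s≤s a<b) = a<b

  pred-<-suc : ∀ {a n} → 1 ≤ a → a < suc n → pred a < n
  pred-<-suc {suc a} _ (s≤s a<n) = a<n

  Increasing : (ℕ → ℕ) → Set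
  Increasing Φ = ∀ r → Φ r < Φ (suc r)

  increasing-≥ : ∀ {Φ} → Increasing Φ → ∀ r → Φ 0 ≤ Φ r
  increasing-≥ inc zero = ≤-refl
  increasing-≥ inc (suc r) = ≤-trans (increasing-≥ inc r) (<⇒≤ (inc r))

  -- Reading zs at the positions Φ 0 < Φ 1 < … < Φ (K-1) < length zs gives a
  -- sublist of zs.  By recursion on zs: keep its head iff Φ 0 = 0.
  select : ∀ (zs : List ℕ) (Φ : ℕ → ℕ) K → Increasing Φ → (∀ r → r < K → Φ r < length zs) →
           applyUpTo (λ r → lookupD zs (Φ r)) K ⊆ zs
  select zs Φ zero inc bounded = minimum zs
  select [] Φ (suc K) inc bounded with bounded 0 (s≤s z≤n)
  ... | ()
  select (z ∷ zs) Φ (suc K) inc bounded = byFirstPosition (Φ 0) refl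
    where
    Goal : Set
    Goal = applyUpTo (λ r → lookupD (z ∷ zs) (Φ r)) (suc K) ⊆ (z ∷ zs)
    byFirstPosition : ∀ p → Φ 0 ≡ p → Goal
    byFirstPosition zero Φ0 = head≡z ∷ keepTail
      where
      positive : ∀ r → 1 ≤ Φ (suc r)
      positive r = ≤-trans (s≤s z≤n) (inc r)
      head≡z : lookupD (z ∷ zs) (Φ 0) ≡ z
      head≡z rewrite Φ0 = refl
      keepTail : applyUpTo (λ r → lookupD (z ∷ zs) (Φ (suc r))) K ⊆ zs
      keepTail rewrite applyUpTo-cong (λ r → lookupD (z ∷ zs) (Φ (suc r))) (λ r → lookupD zs (pred (Φ (suc r)))) K
                         (λ r → lookup-∷ z zs (Φ (suc r)) (positive r)) =
        select zs (λ r → pred (Φ (suc r))) K (λ r → pred-< (positive r) (inc (suc r)))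
               (λ r r<K → pred-<-suc (positive r) (bounded (suc r) (s≤s r<K)))
    byFirstPosition (suc _) Φ0 = z ∷ʳ dropHead
      where
      positive : ∀ r → 1 ≤ Φ r
      positive r = ≤-trans (s≤s z≤n) (≤-trans (≤-reflexive (sym Φ0)) (increasing-≥ inc r))
      dropHead : applyUpTo (λ r → lookupD (z ∷ zs) (Φ r)) (suc K) ⊆ zs
      dropHead rewrite applyUpTo-cong (λ r → lookupD (z ∷ zs) (Φ r)) (λ r → lookupD zs (pred (Φ r))) (suc K)
                         (λ r → lookup-∷ z zs (Φ r) (positive r)) =
        select zs (λ r → pred (Φ r)) (suc K) (λ r → pred-< (positive r) (inc r))
               (λ r r<K → pred-<-suc (positive r) (bounded r r<K))

open FiniteRamsey using (ramsey; ramseyBound; Homogeneous)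
open OrderInvariance using (SameType; formula-invariant; <-+1)
open FiniteFamilies using (sumOver; sumOver-≤; sumOver-strict)
open Interpolation using (module Interpolate)
open AscendingLists using (Ascending; lookupD; range; length-range; sublist-of-range; lookup-increasing; lookup-bounded;
                           lookup-applyUpTo; select)

open import Data.Nat as ℕ using (ℕ; zero; suc; z≤n; s≤s)
import Data.Nat.Properties as ℕP
open import Data.Nat.DivMod using (_mod_; m<n⇒m%n≡m)
open import Data.Bool using (Bool; true; false)
open import Data.Fin using (Fin; zero; suc; toℕ; combine; remQuot)
import Data.Fin.Properties as FinP
open import Data.Fin.Subset using (Subset; _∈_)
open import Data.Fin.Subset.Properties using (⊆-antisym)
open import Data.Vec using (tabulate)
open import Data.Vec.Properties using (lookup∘tabulate; []=⇒lookup; lookup⇒[]=)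
open import Data.Rational using (ℚ; _<_; 0ℚ; 1ℚ; _+_)
import Data.Rational.Properties as ℚP
open import Data.List using (List; length; applyUpTo)
open import Data.List.Relation.Binary.Sublist.Propositional using (_⊆_)
open import Data.List.Relation.Unary.All using (All)
open import Data.List.Properties using (length-applyUpTo)
open import Data.Product using (Σ; ∃; _×_; _,_; proj₁; proj₂; uncurry)
open import Data.Sum using (inj₁; inj₂)
open import Data.Unit using (⊤; tt)
open import Data.Empty using (⊥-elim)
open import Relation.Nullary using (Dec; yes; no; does)
open import Relation.Binary.Definitions using (Trichotomous; Irreflexive; Asymmetric; tri<; tri≈; tri>)
open import Relation.Binary.PropositionalEquality
open import Function using (_⇔_; mk⇔; Equivalence)
open Equivalence using (to; from)
open import Function.Properties.Equivalence using () renaming (refl to ⇔-refl; sym to ⇔-sym; trans to ⇔-trans)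

module _ {A B : Set} {_<ᴬ_ : A → A → Set} {_<ᴮ_ : B → B → Set}
         (compare : Trichotomous _≡_ _<ᴬ_) (irrefl : Irreflexive _≡_ _<ᴮ_) (asym : Asymmetric _<ᴮ_)
         (E : A → Set) (f : A → B) (mono : ∀ {x y} → E x → E y → x <ᴬ y → f x <ᴮ f y) where

  monotone-reflects : ∀ {x y} → E x → E y → f x <ᴮ f y → x <ᴬ y
  monotone-reflects {x} {y} Ex Ey fx<fy with compare x y
  ... | tri< x<y _ _ = x<y
  ... | tri≈ _ refl _ = ⊥-elim (irrefl refl fx<fy)
  ... | tri> _ _ y<x = ⊥-elim (asym fx<fy (mono Ey Ex y<x))

  monotone-injective : ∀ {x y} → E x → E y → f x ≡ f y → x ≡ y
  monotone-injective {x} {y} Ex Ey fx≡fy with compare x y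
  ... | tri< x<y _ _ = ⊥-elim (irrefl fx≡fy (mono Ex Ey x<y))
  ... | tri≈ _ x≡y _ = x≡y
  ... | tri> _ _ y<x = ⊥-elim (irrefl (sym fx≡fy) (mono Ey Ex y<x))

toℚ : ℕ → ℚ
toℚ zero = 0ℚ
toℚ (suc n) = toℚ n + 1ℚ

toℚ-mono : ∀ {m n} → m ℕ.< n → toℚ m < toℚ n
toℚ-mono {m} {suc n} (s≤s m≤n) with ℕP.m≤n⇒m<n∨m≡n m≤n
... | inj₁ m<n = ℚP.<-trans (toℚ-mono m<n) (<-+1 (toℚ n))
... | inj₂ refl = <-+1 (toℚ n)

toℚ-reflects : ∀ {m n} → toℚ m < toℚ n → m ℕ.< n
toℚ-reflects = monotone-reflects ℕP.<-cmp ℚP.<-irrefl ℚP.<-asym (λ _ → ⊤) toℚ (λ _ _ → toℚ-mono) tt tt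

toℚ-injective : ∀ {m n} → toℚ m ≡ toℚ n → m ≡ n
toℚ-injective = monotone-injective ℕP.<-cmp ℚP.<-irrefl ℚP.<-asym (λ _ → ⊤) toℚ (λ _ _ → toℚ-mono) tt tt

-- The endpoints of an interval: false is the left, true the right endpoint.
endpoint : D → Bool → ℚ
endpoint ((x , y) , _) false = x
endpoint ((x , y) , _) true = y

IsEndpoint : ∀ {n} → (Fin n → D) → ℚ → Set
IsEndpoint {n} w q = Σ (Fin n) λ a → Σ Bool λ b → q ≡ endpoint (w a) b

sameType-along : ∀ {n} (ρ ρ' : Fin n → ℚ) (E : ℚ → Set) (G : ℚ → ℚ) →
                 (∀ {q q'} → E q → E q' → q < q' → G q < G q') →
                 (∀ i → E (ρ i)) → (∀ i → ρ' i ≡ G (ρ i)) → SameType ρ ρ'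
sameType-along ρ ρ' E G mono inE ρ'≡ i j
  rewrite ρ'≡ i | ρ'≡ j =
    mk⇔ (mono (inE i) (inE j)) (monotone-reflects ℚP.<-cmp ℚP.<-irrefl ℚP.<-asym E G mono (inE i) (inE j))

Γ-transfer : (E : ℚ → Set) (G : ℚ → ℚ) → (∀ {q q'} → E q → E q' → q < q' → G q < G q') →
             ∀ φ (d₁ d₂ d₁' d₂' : D) → (∀ b → E (endpoint d₁ b)) → (∀ b → E (endpoint d₂ b)) →
             (∀ b → endpoint d₁' b ≡ G (endpoint d₁ b)) → (∀ b → endpoint d₂' b ≡ G (endpoint d₂ b)) →
             ΓRel φ d₁ d₂ ⇔ ΓRel φ d₁' d₂'
Γ-transfer E G mono φ ((x , y) , _) ((u , v) , _) ((x' , y') , _) ((u' , v') , _) E₁ E₂ moved₁ moved₂ =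
  formula-invariant φ (sameType-along (env4 x y u v) (env4 x' y' u' v') E G mono inE moved)
  where
  inE : ∀ i → E (env4 x y u v i)
  inE zero = E₁ false
  inE (suc zero) = E₁ true
  inE (suc (suc zero)) = E₂ false
  inE (suc (suc (suc zero))) = E₂ true
  moved : ∀ i → env4 x' y' u' v' i ≡ G (env4 x y u v i)
  moved zero = moved₁ false
  moved (suc zero) = moved₁ true
  moved (suc (suc zero)) = moved₂ false
  moved (suc (suc (suc zero))) = moved₂ true

before : Bool → Bool → Formula 4
before b b' = first b ≺ second b'
  where
  first second : Bool → Fin 4
  first false = zero
  first true = suc zero
  second false = suc (suc zero)
  second true = suc (suc (suc zero))

Γ-before : ∀ d d' b b' → ΓRel (before b b') d d' ⇔ (endpoint d b < endpoint d' b')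
Γ-before ((x , y) , _) ((u , v) , _) false false = ⇔-refl
Γ-before ((x , y) , _) ((u , v) , _) false true = ⇔-refl
Γ-before ((x , y) , _) ((u , v) , _) true false = ⇔-refl
Γ-before ((x , y) , _) ((u , v) , _) true true = ⇔-refl

sameInterval : Formula 4
sameInterval = (zero ≈ suc (suc zero)) ∧' (suc zero ≈ suc (suc (suc zero)))

Γ-sameInterval : ∀ d d' → ΓRel sameInterval d d' ⇔ (pt d ≡ pt d')
Γ-sameInterval ((x , y) , _) ((u , v) , _) =
  mk⇔ (λ (x≡u , y≡v) → cong₂ _,_ x≡u y≡v) (λ { refl → refl , refl })

indicator : {A : Set} → Dec A → ℕ
indicator (yes _) = 1
indicator (no _) = 0

endpointsBelow : D → ℚ → ℕ
endpointsBelow d q = indicator (endpoint d false ℚP.<? q) ℕ.+ indicator (endpoint d true ℚP.<? q)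

rank : ∀ {n} → (Fin n → D) → ℚ → ℕ
rank w q = sumOver (λ a → endpointsBelow (w a) q)

rank-bounded : ∀ {n} (w : Fin n → D) q → rank w q ℕ.≤ n ℕ.* 2
rank-bounded w q = sumOver-≤ (λ a → endpointsBelow (w a) q) λ a →
  ℕP.+-mono-≤ (indicator≤1 (endpoint (w a) false ℚP.<? q)) (indicator≤1 (endpoint (w a) true ℚP.<? q))
  where indicator≤1 : {A : Set} (d : Dec A) → indicator d ℕ.≤ 1
        indicator≤1 (yes _) = s≤s z≤n
        indicator≤1 (no _) = z≤n

indicator-mono : ∀ x {q q'} → q < q' → indicator (x ℚP.<? q) ℕ.≤ indicator (x ℚP.<? q')
indicator-mono x {q} {q'} q<q' with x ℚP.<? q | x ℚP.<? q'
... | yes _ | yes _ = ℕP.≤-refl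
... | yes x<q | no x≮q' = ⊥-elim (x≮q' (ℚP.<-trans x<q q<q'))
... | no _ | _ = z≤n

indicator-step : ∀ x {q'} → x < q' → indicator (x ℚP.<? x) ℕ.< indicator (x ℚP.<? q')
indicator-step x {q'} x<q' with x ℚP.<? x | x ℚP.<? q'
... | yes x<x | _ = ⊥-elim (ℚP.<-irrefl refl x<x)
... | no _ | yes _ = s≤s z≤n
... | no _ | no x≮q' = ⊥-elim (x≮q' x<q')

endpointsBelow-mono : ∀ d {q q'} → q < q' → endpointsBelow d q ℕ.≤ endpointsBelow d q'
endpointsBelow-mono d q<q' = ℕP.+-mono-≤ (indicator-mono (endpoint d false) q<q') (indicator-mono (endpoint d true) q<q')

endpointsBelow-step : ∀ d b {q'} → endpoint d b < q' → endpointsBelow d (endpoint d b) ℕ.< endpointsBelow d q'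
endpointsBelow-step d false x<q' =
  ℕP.+-mono-<-≤ (indicator-step (endpoint d false) x<q') (indicator-mono (endpoint d true) x<q')
endpointsBelow-step d true y<q' =
  ℕP.+-mono-≤-< (indicator-mono (endpoint d false) y<q') (indicator-step (endpoint d true) y<q')

rank-increasing : ∀ {n} (w : Fin n → D) {q q'} → IsEndpoint w q → q < q' → rank w q ℕ.< rank w q'
rank-increasing w {q} {q'} (a , b , refl) q<q' =
  sumOver-strict (λ a' → endpointsBelow (w a') q) (λ a' → endpointsBelow (w a') q')
                 (λ a' → endpointsBelow-mono (w a') q<q') a (endpointsBelow-step (w a) b q<q')

hasPreimage? : ∀ {m n} (w : Fin m → Fin n) s → Dec (∃ λ i → w i ≡ s)
hasPreimage? w s = FinP.any? (λ i → w i FinP.≟ s)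

image : ∀ {m n} → (Fin m → Fin n) → Subset n
image w = tabulate (λ s → does (hasPreimage? w s))

∈-image⁻ : ∀ {m n} (w : Fin m → Fin n) s → s ∈ image w → ∃ λ i → w i ≡ s
∈-image⁻ w s s∈ with hasPreimage? w s
                   | trans (sym (lookup∘tabulate (λ s → does (hasPreimage? w s)) s)) ([]=⇒lookup s∈)
... | yes hit | _ = hit
... | no _ | ()

∈-image⁺ : ∀ {m n} (w : Fin m → Fin n) s → (∃ λ i → w i ≡ s) → s ∈ image w
∈-image⁺ w s hit =
  lookup⇒[]= s _ (trans (lookup∘tabulate (λ s → does (hasPreimage? w s)) s) (found (hasPreimage? w s)))
  where found : (d : Dec (∃ λ i → w i ≡ s)) → does d ≡ true
        found (yes _) = refl
        found (no miss) = ⊥-elim (miss hit)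

image-unique : ∀ {m n} (w : Fin m → Fin n) (X : Subset n) →
               (∀ s → s ∈ X ⇔ (∃ λ i → w i ≡ s)) → image w ≡ X
image-unique w X sameElements =
  ⊆-antisym (λ {s} s∈ → from (sameElements s) (∈-image⁻ w s s∈))
            (λ {s} s∈ → ∈-image⁺ w s (to (sameElements s) s∈))

-- Spreading U+1 positions apart: u ↦ K + (K+1)·u, so that distinct images
-- are more than K apart and leave room for K positions above each of them,
-- all below Mb.
module Spread (K U : ℕ) where
  spread : ℕ → ℕ
  spread u = K ℕ.+ suc K ℕ.* u

  Mb : ℕ
  Mb = suc (spread U ℕ.+ K)

  spread-mono : ∀ {u u'} → u ℕ.< u' → spread u ℕ.< spread u'
  spread-mono u<u' = ℕP.+-monoʳ-< K (ℕP.*-monoʳ-< (suc K) u<u')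

  spread-gap : ∀ u u' → spread u ℕ.< spread u' → suc K ℕ.+ spread u ℕ.≤ spread u'
  spread-gap u u' lt = begin
    suc K ℕ.+ spread u        ≡⟨ ℕP.+-suc K (K ℕ.+ suc K ℕ.* u) ⟨
    K ℕ.+ (suc K ℕ.+ suc K ℕ.* u) ≡⟨ cong (K ℕ.+_) (ℕP.*-suc (suc K) u) ⟨
    K ℕ.+ suc K ℕ.* suc u     ≤⟨ ℕP.+-monoʳ-≤ K (ℕP.*-monoʳ-≤ (suc K) u<u') ⟩
    spread u'                 ∎
    where
    open ℕP.≤-Reasoning
    u<u' : u ℕ.< u'
    u<u' = monotone-reflects ℕP.<-cmp ℕP.<-irrefl ℕP.<-asym (λ _ → ⊤) spread (λ _ _ → spread-mono) tt tt lt

  spread+K<Mb : ∀ u → u ℕ.≤ U → spread u ℕ.+ K ℕ.< Mb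
  spread+K<Mb u u≤U = s≤s (ℕP.+-monoˡ-≤ K (ℕP.+-monoʳ-≤ K (ℕP.*-monoʳ-≤ (suc K) u≤U)))

  spread<Mb : ∀ u → u ℕ.≤ U → spread u ℕ.< Mb
  spread<Mb u u≤U = ℕP.≤-<-trans (ℕP.m≤m+n (spread u) K) (spread+K<Mb u u≤U)

  K<Mb : K ℕ.< Mb
  K<Mb = s≤s (ℕP.m≤n+m K (spread U))

-- The finite substructure of Γ formed by the intervals [a, a+1+d] with
-- a, d < N, indexed by Fin (N·N) via (a, d) ↦ N·a + d.  Every interval with
-- endpoints a < b < N is among them.
module Grid (N : ℕ) {{_ : ℕ.NonZero N}} where
  Point : Set
  Point = Fin (N ℕ.* N)

  digits : Point → Fin N × Fin N
  digits = remQuot {N} N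

  fromDigits : Fin N × Fin N → ℕ × ℕ
  fromDigits (a , d) = toℕ a , toℕ a ℕ.+ suc (toℕ d)

  endpoints : Point → ℕ × ℕ
  endpoints s = fromDigits (digits s)

  left<right : ∀ s → toℚ (proj₁ (endpoints s)) < toℚ (proj₂ (endpoints s))
  left<right s = toℚ-mono (ℕP.m<m+n (toℕ (proj₁ (digits s))) (s≤s z≤n))

  interval : Point → D
  interval s = (toℚ (proj₁ (endpoints s)) , toℚ (proj₂ (endpoints s))) , left<right s

  S : FinStr
  S = record { size = N ℕ.* N ; rel = λ φ s t → ΓRel φ (interval s) (interval t) }

  encode : ℕ → ℕ → Point
  encode a b = combine (a mod N) ((b ℕ.∸ suc a) mod N)

  toℕ-mod : ∀ m → m ℕ.< N → toℕ (m mod N) ≡ m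
  toℕ-mod m m<N = trans (FinP.toℕ-fromℕ< _) (m<n⇒m%n≡m m<N)

  endpoints-encode : ∀ {a b} → a ℕ.< b → b ℕ.< N → endpoints (encode a b) ≡ (a , b)
  endpoints-encode {a} {b} a<b b<N =
    trans (cong fromDigits (FinP.remQuot-combine {N} {N} (a mod N) ((b ℕ.∸ suc a) mod N)))
          (cong₂ _,_ a-digit (trans (cong₂ (λ x y → x ℕ.+ suc y) a-digit d-digit)
                                    (trans (ℕP.+-suc a (b ℕ.∸ suc a)) (ℕP.m+[n∸m]≡n a<b))))
    where
    a-digit : toℕ (a mod N) ≡ a
    a-digit = toℕ-mod a (ℕP.<-trans a<b b<N)
    d-digit : toℕ ((b ℕ.∸ suc a) mod N) ≡ b ℕ.∸ suc a
    d-digit = toℕ-mod (b ℕ.∸ suc a) (ℕP.≤-<-trans (ℕP.m∸n≤m b (suc a)) b<N)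

  interval-injective : ∀ s t → pt (interval s) ≡ pt (interval t) → s ≡ t
  interval-injective s t same = begin
    s                                    ≡⟨ FinP.combine-remQuot {N} N s ⟨
    uncurry (combine {N} {N}) (digits s) ≡⟨ cong (uncurry (combine {N} {N})) sameDigits ⟩
    uncurry (combine {N} {N}) (digits t) ≡⟨ FinP.combine-remQuot {N} N t ⟩
    t                                    ∎
    where
    open ≡-Reasoning
    a≡ : toℕ (proj₁ (digits s)) ≡ toℕ (proj₁ (digits t))
    a≡ = toℚ-injective (cong proj₁ same)
    d≡ : toℕ (proj₂ (digits s)) ≡ toℕ (proj₂ (digits t))
    d≡ = ℕP.suc-injective (ℕP.+-cancelˡ-≡ (toℕ (proj₁ (digits s))) _ _
           (trans (toℚ-injective (cong proj₂ same)) (cong (λ x → x ℕ.+ suc (toℕ (proj₂ (digits t)))) (sym a≡))))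
    sameDigits : digits s ≡ digits t
    sameDigits = cong₂ _,_ (FinP.toℕ-injective a≡) (FinP.toℕ-injective d≡)

  S-inAge : InAgeΓ S
  S-inAge = record { map = interval ; injective = interval-injective ; preserves = λ φ s t → ⇔-refl }

module Construction (k : ℕ) (H P : FinStr) (embH : EmbΓ H) (embP : EmbΓ P) where
  nH nP : ℕ
  nH = size H
  nP = size P

  intervalH : Fin nH → D
  intervalH = EmbΓ.map embH

  intervalP : Fin nP → D
  intervalP = EmbΓ.map embP

  -- Endpoint ranks in P are < K, endpoint ranks in H are ≤ U.
  K U : ℕ
  K = suc (nP ℕ.* 2)
  U = nH ℕ.* 2

  open Spread K U

  N : ℕ
  N = suc (ramseyBound K k Mb)

  open Grid N public using (S; S-inAge)
  open Grid N using (Point; interval; encode; endpoints; endpoints-encode)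

  rankP : ℚ → ℕ
  rankP = rank intervalP

  rankP<K : ∀ q → rankP q ℕ.< K
  rankP<K q = s≤s (rank-bounded intervalP q)

  module Colouring (χ : Subset (size S) → Fin (suc k)) where
    -- The copy of P whose endpoint of rank r (in P) is placed at ys[r].
    placeP : List ℕ → Fin nP → Point
    placeP ys i = encode (lookupD ys (rankP (endpoint (intervalP i) false)))
                         (lookupD ys (rankP (endpoint (intervalP i) true)))

    colourOf : List ℕ → Fin (suc k)
    colourOf ys = χ (image (placeP ys))

    homogeneousList : Σ (List ℕ) λ zs → zs ⊆ range 0 N × length zs ≡ Mb ×
                        Σ (Fin (suc k)) λ κ → Homogeneous colourOf K zs κ
    homogeneousList = ramsey K k Mb (range 0 N) rangeLong colourOf
      where rangeLong = subst (ramseyBound K k Mb ℕ.≤_) (sym (length-range 0 N)) (ℕP.n≤1+n _)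

    zs : List ℕ
    zs = proj₁ homogeneousList

    length-zs : length zs ≡ Mb
    length-zs = proj₁ (proj₂ (proj₂ homogeneousList))

    κ : Fin (suc k)
    κ = proj₁ (proj₂ (proj₂ (proj₂ homogeneousList)))

    zs-homogeneous : Homogeneous colourOf K zs κ
    zs-homogeneous = proj₂ (proj₂ (proj₂ (proj₂ homogeneousList)))

    z : ℕ → ℕ
    z r = lookupD zs r

    zs-sorted : Ascending 0 zs × All (ℕ._< N) zs
    zs-sorted = sublist-of-range 0 N (proj₁ (proj₂ homogeneousList))

    z-increasing : ∀ {r r'} → r ℕ.< r' → r' ℕ.< Mb → z r ℕ.< z r'
    z-increasing r<r' r'<Mb = lookup-increasing (proj₁ zs-sorted) r<r' (subst (_ ℕ.<_) (sym length-zs) r'<Mb)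

    z-reflects : ∀ {r r'} → r ℕ.< Mb → r' ℕ.< Mb → z r ℕ.< z r' → r ℕ.< r'
    z-reflects = monotone-reflects ℕP.<-cmp ℕP.<-irrefl ℕP.<-asym (ℕ._< Mb) z
                                   (λ _ r'<Mb r<r' → z-increasing r<r' r'<Mb)

    z<N : ∀ {r} → r ℕ.< Mb → z r ℕ.< N
    z<N {r} r<Mb = lookup-bounded (proj₂ zs-sorted) r (subst (r ℕ.<_) (sym length-zs) r<Mb)

    slot : ℚ → ℕ
    slot q = spread (rank intervalH q)

    slot<Mb : ∀ q → slot q ℕ.< Mb
    slot<Mb q = spread<Mb _ (rank-bounded intervalH q)

    position : ℚ → ℕ
    position q = z (slot q)

    position-increasing : ∀ {q q'} → IsEndpoint intervalH q → IsEndpoint intervalH q' → q < q' →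
                          position q ℕ.< position q'
    position-increasing {q} {q'} Eq _ q<q' = z-increasing (spread-mono (rank-increasing intervalH Eq q<q')) (slot<Mb q')

    embedH-map : Fin nH → Point
    embedH-map a = encode (position (endpoint (intervalH a) false)) (position (endpoint (intervalH a) true))

    endpoints-embedH : ∀ a → endpoints (embedH-map a) ≡
                             (position (endpoint (intervalH a) false) , position (endpoint (intervalH a) true))
    endpoints-embedH a = endpoints-encode (position-increasing (a , false , refl) (a , true , refl) (proj₂ (intervalH a)))
                                          (z<N (slot<Mb _))

    endpoint-embedH : ∀ a b → endpoint (interval (embedH-map a)) b ≡ toℚ (position (endpoint (intervalH a) b))
    endpoint-embedH a false = cong (λ p → toℚ (proj₁ p)) (endpoints-embedH a)
    endpoint-embedH a true = cong (λ p → toℚ (proj₂ p)) (endpoints-embedH a)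

    embedH-transfer : ∀ φ a a' → ΓRel φ (intervalH a) (intervalH a') ⇔
                                 ΓRel φ (interval (embedH-map a)) (interval (embedH-map a'))
    embedH-transfer φ a a' =
      Γ-transfer (IsEndpoint intervalH) (λ q → toℚ (position q))
                 (λ Eq Eq' q<q' → toℚ-mono (position-increasing Eq Eq' q<q'))
                 φ (intervalH a) (intervalH a') (interval (embedH-map a)) (interval (embedH-map a'))
                 (λ b → a , b , refl) (λ b → a' , b , refl) (endpoint-embedH a) (endpoint-embedH a')

    embedH-preserves : ∀ φ a a' → rel H φ a a' ⇔ rel S φ (embedH-map a) (embedH-map a')
    embedH-preserves φ a a' = ⇔-trans (EmbΓ.preserves embH φ a a') (embedH-transfer φ a a')

    -- Injectivity, via the formula expressing that two intervals coincide.
    embedH-injective : ∀ {a a'} → embedH-map a ≡ embedH-map a' → a ≡ a'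
    embedH-injective {a} {a'} same = EmbΓ.injective embH a a'
      (to (Γ-sameInterval (intervalH a) (intervalH a'))
        (to (EmbΓ.preserves embH sameInterval a a')
          (from (embedH-preserves sameInterval a a')
            (subst (λ s → ΓRel sameInterval (interval (embedH-map a)) (interval s)) same
              (from (Γ-sameInterval (interval (embedH-map a)) (interval (embedH-map a))) refl)))))

    embedH : Emb H S
    embedH = record { map = embedH-map ; injective = embedH-injective ; preserves = embedH-preserves }

    -- Every copy of P inside the image of embedH is placeP ys for some
    -- K-sublist ys of zs, hence has colour κ.
    module CopyOfP (X : Subset (size S)) (isCopy : IsCopy P S X) (X⊆ : X ⊆Im embedH) where
      copyEmb : Emb P S
      copyEmb = proj₁ isCopy

      copy : Fin nP → Point
      copy = map copyEmb

      preimage : Fin nP → Fin nH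
      preimage i = proj₁ (X⊆ (copy i) (from (proj₂ isCopy (copy i)) (i , refl)))

      embedH-preimage : ∀ i → embedH-map (preimage i) ≡ copy i
      embedH-preimage i = proj₂ (X⊆ (copy i) (from (proj₂ isCopy (copy i)) (i , refl)))

      source targetRank target : Fin nP → Bool → ℕ
      source i b = rankP (endpoint (intervalP i) b)
      targetRank i b = rank intervalH (endpoint (intervalH (preimage i)) b)
      target i b = spread (targetRank i b)

      endpoint-copy : ∀ i b → endpoint (interval (copy i)) b ≡ toℚ (z (target i b))
      endpoint-copy i b =
        trans (cong (λ s → endpoint (interval s) b) (sym (embedH-preimage i))) (endpoint-embedH (preimage i) b)

      order-copy : ∀ i b j b' → (endpoint (intervalP i) b < endpoint (intervalP j) b') ⇔
                                (endpoint (interval (copy i)) b < endpoint (interval (copy j)) b')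
      order-copy i b j b' =
        ⇔-trans (⇔-sym (Γ-before (intervalP i) (intervalP j) b b'))
          (⇔-trans (⇔-sym (EmbΓ.preserves embP (before b b') i j))
            (⇔-trans (preserves copyEmb (before b b') i j) (Γ-before (interval (copy i)) (interval (copy j)) b b')))

      order-target : ∀ i b j b' → (endpoint (intervalP i) b < endpoint (intervalP j) b') ⇔ (target i b ℕ.< target j b')
      order-target i b j b' = ⇔-trans (order-copy i b j b') (mk⇔
        (λ lt → z-reflects (slot<Mb _) (slot<Mb _)
                  (toℚ-reflects (subst₂ _<_ (endpoint-copy i b) (endpoint-copy j b') lt)))
        (λ lt → subst₂ _<_ (sym (endpoint-copy i b)) (sym (endpoint-copy j b'))
                  (toℚ-mono (z-increasing lt (slot<Mb _)))))

      source-reflects : ∀ i b j b' → source i b ℕ.< source j b' → endpoint (intervalP i) b < endpoint (intervalP j) b'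
      source-reflects i b j b' = monotone-reflects ℚP.<-cmp ℕP.<-irrefl ℕP.<-asym (IsEndpoint intervalP) rankP
                                   (λ Eq _ → rank-increasing intervalP Eq) (i , b , refl) (j , b' , refl)

      target-mono : ∀ i b j b' → source j b' ℕ.< source i b → target j b' ℕ.< target i b
      target-mono i b j b' lt = to (order-target j b' i b) (source-reflects j b' i b lt)

      target-resp : ∀ i b j b' → source j b' ≡ source i b → target j b' ≡ target i b
      target-resp i b j b' same with ℕP.<-cmp (target j b') (target i b)
      ... | tri< lt _ _ =
        ⊥-elim (ℕP.<-irrefl same (rank-increasing intervalP (j , b' , refl) (from (order-target j b' i b) lt)))
      ... | tri≈ _ eq _ = eq
      ... | tri> _ _ gt =
        ⊥-elim (ℕP.<-irrefl (sym same) (rank-increasing intervalP (i , b , refl) (from (order-target i b j b') gt)))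

      open Interpolate nP K Mb source target (λ i b → rankP<K _) (λ i b → ℕP.m≤m+n K _)
             (λ i b j b' → spread-gap (targetRank j b') (targetRank i b)) target-mono target-resp
             (λ i b → spread+K<Mb (targetRank i b) (rank-bounded intervalH _)) K<Mb

      ys : List ℕ
      ys = applyUpTo (λ r → z (Φ r)) K

      ys-at-source : ∀ i b → lookupD ys (source i b) ≡ z (target i b)
      ys-at-source i b = trans (lookup-applyUpTo (λ r → z (Φ r)) K (source i b) (rankP<K _)) (cong z (Φ-σ i b))

      placeP-ys : ∀ i → placeP ys i ≡ copy i
      placeP-ys i = trans (cong₂ encode (ys-at-source i false) (ys-at-source i true)) (embedH-preimage i)

      image≡X : image (placeP ys) ≡ X
      image≡X = image-unique (placeP ys) X λ s → ⇔-trans (proj₂ isCopy s)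
        (mk⇔ (λ (i , eq) → i , trans (placeP-ys i) eq) (λ (i , eq) → i , trans (sym (placeP-ys i)) eq))

      ys⊆zs : ys ⊆ zs
      ys⊆zs = select zs Φ K Φ-increasing (λ r r<K → subst (Φ r ℕ.<_) (sym length-zs) (Φ<Mb r r<K))

      monochromatic : χ X ≡ κ
      monochromatic = trans (cong χ (sym image≡X)) (zs-homogeneous ys ys⊆zs (length-applyUpTo (λ r → z (Φ r)) K))

  arrow : Arrow S H P (suc k)
  arrow χ = embedH , κ , λ X isCopy X⊆ → CopyOfP.monochromatic X isCopy X⊆
    where open Colouring χ

mainTheorem3 : RamseyAgeΓ
mainTheorem3 zero () H P embH embP
mainTheorem3 (suc k) _ H P embH embP = S , S-inAge , arrow
  where open Construction k H P embH embP
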